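{- Let $G=(V,E)$ be a graph with $|V|=\aleph_0$ and let $f\colon V\to\mathit{CN}$ be such that $(G,f)\in\mathcal C$. If $P$ is a hereditary property and $P(G,f)$ holds, then $G$ possesses a perfect $f$-factor.
   Context: A graph is a pair $G=(V,E)$ with $V$ a nonempty set and $E\subseteq\{e\subseteq V: |e|=2\}$. $\mathit{CN}$ denotes the class of cardinals. For $F\subseteq E$ and $x\in V$, $d_F(x)=|\{e\in F: x\in e\}|$. For $f\colon V\to\mathit{CN}$, an $f$-factor of $G$ is a set $F\subseteq E$ with $d_F(x)\le f(x)$ for all $x\in V$; it is perfect if $d_F(x)=f(x)$ for all $x\in V$. $\mathcal C$ is the class of all pairs $(G,f)$ with $G=(V,E)$ a graph, $f\colon V\to\mathit{CN}$, and $f(x)\le d_E(x)$ for all $x\in V$. For an edge $\{x,y\}\in E$, $G-\{x,y\}$ denotes the graph $(V,E\setminus\{\{x,y\}\})$ (the edge is deleted, not the vertices). For $x,y\in V$, $f_{x,y}\colon V\to\mathit{CN}$ is defined by $f_{x,y}(v)=f(v)-1$ if $v\in\{x,y\}$ and $1\le f(v)<\aleph_0$, and $f_{x,y}(v)=f(v)$ otherwise. A property $P$ is a formula with two free variables; $P(G,f)$ means that $(G,f)\in\mathcal C$ and $(G,f)$ satisfies $P$. $P$ is hereditary if for every $(G,f)$ with $P(G,f)$ and every vertex $x\in V(G)$ with $f(x)>0$ there is a vertex $y\in V(G)$ with $f(y)>0$, $\{x,y\}\in E(G)$, and $P(G-\{x,y\},f_{x,y})$. -}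

module Defs where

open import Data.Nat using (ℕ; zero; suc)
import Data.Nat as ℕ
open import Data.Fin using (Fin)
open import Data.Product using (Σ; ∃; _×_; _,_)
open import Data.Sum using (_⊎_)
open import Data.Empty using (⊥)
open import Data.Unit using (⊤)
open import Relation.Nullary using (¬_; Dec; yes; no)
open import Relation.Binary.PropositionalEquality using (_≡_; refl; cong; sym; trans)
open import Function.Bundles using (_↔_; Inverse)
open import Function.Definitions using (Injective)

-- Cardinals that can occur as values of f : V → CN for (G,f) ∈ 𝒞 with
-- |V| = ℵ0: since f(x) ≤ d_E(x) ≤ ℵ0, only finite cardinals and ℵ0 occur.
data Card : Set where
  fin : ℕ → Card
  ℵ₀  : Card

⟦_⟧ : Card → Set
⟦ fin n ⟧ = Fin n
⟦ ℵ₀ ⟧    = ℕ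

HasCard : {A : Set} → (A → Set) → Card → Set
HasCard {A} S c =
  Σ (⟦ c ⟧ → A) λ g →
    Injective _≡_ _≡_ g × (∀ i → S (g i)) × (∀ a → S a → ∃ λ i → g i ≡ a)

CardLe : {A : Set} → Card → (A → Set) → Set
CardLe {A} c S = Σ (⟦ c ⟧ → A) λ g → Injective _≡_ _≡_ g × (∀ i → S (g i))

-- a graph on vertex set V: edge set given as a symmetric irreflexive relation
-- (E x y  means  {x,y} ∈ E)
IsGraph : {V : Set} → (V → V → Set) → Set
IsGraph {V} E = (∀ x y → E x y → E y x) × (∀ x → ¬ E x x)

-- d_E(x) is the cardinality of {y | {x,y} ∈ E}
-- (G,f) ∈ 𝒞 : G graph and f(x) ≤ d_E(x) for all x
InC : {V : Set} → (V → V → Set) → (V → Card) → Set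
InC {V} E f = IsGraph E × (∀ x → CardLe (f x) (E x))

deleteEdge : {V : Set} → (V → V → Set) → V → V → (V → V → Set)
deleteEdge E x y a b = E a b × ¬ ((a ≡ x × b ≡ y) ⊎ (a ≡ y × b ≡ x))

Positive : Card → Set
Positive (fin zero) = ⊥
Positive _          = ⊤

predCard : Card → Card
predCard (fin zero)    = fin zero
predCard (fin (suc n)) = fin n
predCard ℵ₀            = ℵ₀

fxy : {V : Set} → ((a b : V) → Dec (a ≡ b)) → (V → Card) → V → V → V → Card
fxy _≟_ f x y v with v ≟ x | v ≟ y
... | yes _ | _     = predCard (f v)
... | no _  | yes _ = predCard (f v)
... | no _  | no _  = f v

decEqV : {V : Set} → (ℕ ↔ V) → (a b : V) → Dec (a ≡ b)
decEqV e a b with Inverse.from e a ℕ.≟ Inverse.from e b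
... | yes p = yes (trans (sym (Inverse.strictlyInverseˡ e a))
                   (trans (cong (Inverse.to e) p) (Inverse.strictlyInverseˡ e b)))
... | no ¬p = no λ q → ¬p (cong (Inverse.from e) q)

-- a property of pairs (G,f) with vertex set V;
-- "P(G,f)" means (G,f) ∈ 𝒞 and (G,f) satisfies P
Property : Set → Set₁
Property V = (V → V → Set) → (V → Card) → Set

Holds : {V : Set} → Property V → (V → V → Set) → (V → Card) → Set
Holds P E f = InC E f × P E f

Hereditary : {V : Set} → ((a b : V) → Dec (a ≡ b)) → Property V → Set₁
Hereditary {V} _≟_ P =
  (E : V → V → Set) (f : V → Card) → IsGraph E → Holds P E f →
  (x : V) → Positive (f x) →
  Σ V λ y → Positive (f y) × E x y ×
            Holds P (deleteEdge E x y) (fxy _≟_ f x y)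

PerfectFactor : {V : Set} → (V → V → Set) → (V → Card) → (V → V → Set) → Set
PerfectFactor {V} E f F =
  (∀ x y → F x y → E x y) × (∀ x y → F x y → F y x) × (∀ x → HasCard (F x) (f x))

{-# OPTIONS --safe #-}

-- Visit the vertices along a sequence that meets each of them infinitely often and act
-- greedily: at a visit of x with f(x) > 0, heredity yields an edge {x,y} such that P still
-- holds after deleting {x,y} and lowering f at x and y; put {x,y} into F. Throughout,
-- f(v) = (F-edges at v so far) + (current demand at v), and no edge is chosen twice since
-- it is deleted once chosen. Each visit of v adds an F-edge at v unless the demand of v is
-- already 0, so in the limit d_F(v) = f(v), whether f(v) is finite or ℵ₀.

module Submission where

open import Defs
open import Data.Nat using (ℕ; zero; suc; _+_; _≤_; _<_; _≤′_; ≤′-refl; ≤′-step; _⊔_; z≤n; s≤s)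
open import Data.Nat.Properties
open import Data.Fin as Fin using (toℕ; fromℕ<)
open import Data.Fin.Properties using (toℕ-injective; toℕ<n; toℕ-fromℕ<; fromℕ<-toℕ)
open import Data.Product using (Σ; ∃; _×_; _,_; proj₁; proj₂)
open import Data.Sum using (_⊎_; inj₁; inj₂)
open import Data.Unit using (⊤; tt)
open import Data.List using (List; []; _∷_; [_]; _++_; length; lookup)
open import Data.List.Properties using (length-++)
open import Data.List.Membership.Propositional using (_∈_)
open import Data.List.Membership.Propositional.Properties using (∈-++⁺ʳ; ∈-++⁻; ∈-lookup)
open import Data.List.Relation.Unary.Any using (here; index)
open import Data.List.Relation.Unary.Any.Properties using (lookup-index)
import Data.List.Relation.Unary.All as All
open import Data.List.Relation.Unary.AllPairs using ([]; _∷_)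
open import Data.List.Relation.Unary.Unique.Propositional using (Unique)
open import Data.List.Relation.Unary.Unique.Propositional.Properties using (++⁺)
open import Data.List.Relation.Binary.Disjoint.Propositional using (Disjoint)
open import Relation.Nullary using (¬_; yes; no; contradiction)
open import Relation.Binary.Definitions using (DecidableEquality)
open import Relation.Binary.PropositionalEquality using (_≡_; refl; sym; trans; cong; subst; module ≡-Reasoning)
open import Function using (_∘_)
open import Function.Bundles using (_↔_; Inverse)
open import Function.Definitions using (Injective)


-- Cardinal arithmetic

_+ᶜ_ : ℕ → Card → Card
l +ᶜ fin k = fin (l + k)
l +ᶜ ℵ₀    = ℵ₀

+ᶜ-identityˡ : ∀ c → 0 +ᶜ c ≡ c
+ᶜ-identityˡ (fin k) = refl
+ᶜ-identityˡ ℵ₀      = refl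

+ᶜ-assoc : ∀ l m c → l +ᶜ (m +ᶜ c) ≡ (l + m) +ᶜ c
+ᶜ-assoc l m (fin k) = cong fin (sym (+-assoc l m k))
+ᶜ-assoc l m ℵ₀      = refl

positive⇒1+pred : ∀ {c} → Positive c → c ≡ 1 +ᶜ predCard c
positive⇒1+pred {fin (suc k)} _ = refl
positive⇒1+pred {ℵ₀}          _ = refl

zero⊎positive : ∀ c → c ≡ fin 0 ⊎ Positive c
zero⊎positive (fin zero)    = inj₁ refl
zero⊎positive (fin (suc k)) = inj₂ tt
zero⊎positive ℵ₀            = inj₂ tt

_≤ᶜ_ : ℕ → Card → Set
l ≤ᶜ fin k = l ≤ k
l ≤ᶜ ℵ₀    = ⊤

≤ᶜ-+ᶜ : ∀ l c → l ≤ᶜ (l +ᶜ c)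
≤ᶜ-+ᶜ l (fin k) = m≤m+n l k
≤ᶜ-+ᶜ l ℵ₀      = tt

≤-≤ᶜ-trans : ∀ {l m} c → l ≤ m → m ≤ᶜ c → l ≤ᶜ c
≤-≤ᶜ-trans (fin k) l≤m m≤k = ≤-trans l≤m m≤k
≤-≤ᶜ-trans ℵ₀      _   _   = tt

toℕᶜ : ∀ c → ⟦ c ⟧ → ℕ
toℕᶜ (fin k) = toℕ
toℕᶜ ℵ₀      i = i

toℕᶜ-injective : ∀ c → Injective _≡_ _≡_ (toℕᶜ c)
toℕᶜ-injective (fin k) = toℕ-injective
toℕᶜ-injective ℵ₀      = λ eq → eq

toℕᶜ<ᶜ : ∀ c (i : ⟦ c ⟧) → suc (toℕᶜ c i) ≤ᶜ c
toℕᶜ<ᶜ (fin k) = toℕ<n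
toℕᶜ<ᶜ ℵ₀      _ = tt

fromℕᶜ : ∀ c p → suc p ≤ᶜ c → ⟦ c ⟧
fromℕᶜ (fin k) p p<k = fromℕ< p<k
fromℕᶜ ℵ₀      p _   = p

toℕᶜ-fromℕᶜ : ∀ c p (p<c : suc p ≤ᶜ c) → toℕᶜ c (fromℕᶜ c p p<c) ≡ p
toℕᶜ-fromℕᶜ (fin k) p p<k = toℕ-fromℕ< p<k
toℕᶜ-fromℕᶜ ℵ₀      p _   = refl

-- Unions of growing lists

lookup-injective : ∀ {A : Set} {xs : List A} → Unique xs → Injective _≡_ _≡_ (lookup xs)
lookup-injective {xs = x ∷ xs} _ {Fin.zero} {Fin.zero} _ = refl
lookup-injective {xs = x ∷ xs} (x∉xs ∷ _) {Fin.zero} {Fin.suc j} eq =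
  contradiction eq (All.lookup x∉xs (∈-lookup j))
lookup-injective {xs = x ∷ xs} (x∉xs ∷ _) {Fin.suc i} {Fin.zero} eq =
  contradiction (sym eq) (All.lookup x∉xs (∈-lookup i))
lookup-injective {xs = x ∷ xs} (_ ∷ unique) {Fin.suc i} {Fin.suc j} eq =
  cong Fin.suc (lookup-injective unique eq)

lookup-++-fromℕ< : ∀ {A : Set} (xs ys : List A) {p} (p<xs : p < length xs) (p<xs++ys : p < length (xs ++ ys)) →
                   lookup (xs ++ ys) (fromℕ< p<xs++ys) ≡ lookup xs (fromℕ< p<xs)
lookup-++-fromℕ< (x ∷ xs) ys {zero}  _         _             = refl
lookup-++-fromℕ< (x ∷ xs) ys {suc p} (s≤s p<xs) (s≤s p<xs++ys) = lookup-++-fromℕ< xs ys p<xs p<xs++ys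

module _ {A : Set} (D : ℕ → List A) where

  concatUpTo : ℕ → List A
  concatUpTo zero    = []
  concatUpTo (suc n) = concatUpTo n ++ D n

  ∈-concatUpTo⁻ : ∀ {a} n → a ∈ concatUpTo n → ∃ λ m → m < n × a ∈ D m
  ∈-concatUpTo⁻ (suc n) a∈ with ∈-++⁻ (concatUpTo n) a∈
  ... | inj₂ a∈Dn = n , ≤-refl , a∈Dn
  ... | inj₁ a∈′ with ∈-concatUpTo⁻ n a∈′
  ...   | m , m<n , a∈Dm = m , m<n⇒m<1+n m<n , a∈Dm

  length-concatUpTo-mono : ∀ {m n} → m ≤′ n → length (concatUpTo m) ≤ length (concatUpTo n)
  length-concatUpTo-mono ≤′-refl = ≤-refl
  length-concatUpTo-mono {m} (≤′-step {n} m≤n) = begin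
    length (concatUpTo m)                   ≤⟨ length-concatUpTo-mono m≤n ⟩
    length (concatUpTo n)                   ≤⟨ m≤m+n _ _ ⟩
    length (concatUpTo n) + length (D n)    ≡⟨ length-++ (concatUpTo n) ⟨
    length (concatUpTo (suc n))             ∎
    where open ≤-Reasoning

  Position : ℕ → Set
  Position p = ∃ λ n → p < length (concatUpTo n)

  elementAt : ∀ {p} → Position p → A
  elementAt (n , p<n) = lookup (concatUpTo n) (fromℕ< p<n)

  elementAt-mono : ∀ {p m n} → m ≤′ n → (p<m : p < length (concatUpTo m)) (p<n : p < length (concatUpTo n)) →
                   elementAt (n , p<n) ≡ elementAt (m , p<m)
  elementAt-mono ≤′-refl _ _ = refl
  elementAt-mono (≤′-step {n} m≤n) p<m p<n+1 =
    trans (lookup-++-fromℕ< (concatUpTo n) (D n) p<n p<n+1) (elementAt-mono m≤n p<m p<n)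
    where p<n = ≤-trans p<m (length-concatUpTo-mono m≤n)

  elementAt-irrelevant : ∀ {p q} → p ≡ q → (i : Position p) (j : Position q) → elementAt i ≡ elementAt j
  elementAt-irrelevant {p} refl (m , p<m) (n , p<n) =
    trans (sym (elementAt-mono (≤⇒≤′ (m≤m⊔n m n)) p<m p<m⊔n)) (elementAt-mono (≤⇒≤′ (m≤n⊔m m n)) p<n p<m⊔n)
    where
    p<m⊔n : p < length (concatUpTo (m ⊔ n))
    p<m⊔n = ≤-trans p<m (length-concatUpTo-mono (≤⇒≤′ (m≤m⊔n m n)))

  elementAt-injective : (∀ n → Unique (concatUpTo n)) →
                        ∀ {p q} (i : Position p) (j : Position q) → elementAt i ≡ elementAt j → p ≡ q
  elementAt-injective unique {p} {q} i@(m , p<m) j@(n , q<n) eq = begin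
    p                                  ≡⟨ toℕ-fromℕ< p<m⊔n ⟨
    toℕ (fromℕ< p<m⊔n)                 ≡⟨ cong toℕ (lookup-injective (unique (m ⊔ n)) eq′) ⟩
    toℕ (fromℕ< q<m⊔n)                 ≡⟨ toℕ-fromℕ< q<m⊔n ⟩
    q                                  ∎
    where
    open ≡-Reasoning
    p<m⊔n : p < length (concatUpTo (m ⊔ n))
    p<m⊔n = ≤-trans p<m (length-concatUpTo-mono (≤⇒≤′ (m≤m⊔n m n)))
    q<m⊔n : q < length (concatUpTo (m ⊔ n))
    q<m⊔n = ≤-trans q<n (length-concatUpTo-mono (≤⇒≤′ (m≤n⊔m m n)))
    eq′ : elementAt (m ⊔ n , p<m⊔n) ≡ elementAt (m ⊔ n , q<m⊔n)
    eq′ = trans (elementAt-irrelevant refl (m ⊔ n , p<m⊔n) i) (trans eq (elementAt-irrelevant refl j (m ⊔ n , q<m⊔n)))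

  elementAt-∈ : ∀ {p} (i : Position p) → ∃ λ n → elementAt i ∈ D n
  elementAt-∈ (n , p<n) with ∈-concatUpTo⁻ n (∈-lookup (fromℕ< p<n))
  ... | m , _ , a∈Dm = m , a∈Dm

  ∈⇒elementAt : ∀ {a n} → a ∈ D n → ∃ λ p → Σ (Position p) λ i → elementAt i ≡ a
  ∈⇒elementAt {a} {n} a∈Dn = toℕ k , (suc n , toℕ<n k) , at-k
    where
    open ≡-Reasoning
    a∈ : a ∈ concatUpTo (suc n)
    a∈ = ∈-++⁺ʳ (concatUpTo n) a∈Dn
    k  = index a∈
    at-k : lookup (concatUpTo (suc n)) (fromℕ< (toℕ<n k)) ≡ a
    at-k = begin
      lookup (concatUpTo (suc n)) (fromℕ< (toℕ<n k)) ≡⟨ cong (lookup (concatUpTo (suc n))) (fromℕ<-toℕ k (toℕ<n k)) ⟩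
      lookup (concatUpTo (suc n)) k                   ≡⟨ lookup-index a∈ ⟨
      a                                               ∎

  hasCard-⋃ : ∀ c → (∀ n → Unique (concatUpTo n)) → (∀ n → length (concatUpTo n) ≤ᶜ c) →
              (∀ l → l ≤ᶜ c → ∃ λ n → l ≤ length (concatUpTo n)) →
              HasCard (λ a → ∃ λ n → a ∈ D n) c
  hasCard-⋃ c unique bounded reaches = g , g-injective , elementAt-∈ ∘ position , g-surjective
    where
    position : ∀ i → Position (toℕᶜ c i)
    position i = reaches _ (toℕᶜ<ᶜ c i)
    g : ⟦ c ⟧ → A
    g = elementAt ∘ position
    g-injective : Injective _≡_ _≡_ g
    g-injective {i} {j} = toℕᶜ-injective c ∘ elementAt-injective unique (position i) (position j)
    g-surjective : ∀ a → (∃ λ n → a ∈ D n) → ∃ λ i → g i ≡ a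
    g-surjective a (_ , a∈Dn) with ∈⇒elementAt a∈Dn
    ... | p , j@(m , p<m) , eq = i , trans (elementAt-irrelevant (toℕᶜ-fromℕᶜ c p p<c) (position i) j) eq
      where
      p<c = ≤-≤ᶜ-trans c p<m (bounded m)
      i   = fromℕᶜ c p p<c

-- A sequence visiting every natural number infinitely often

Recurrent : ∀ {A : Set} → (ℕ → A) → Set
Recurrent u = ∀ a N → ∃ λ n → N ≤ n × u n ≡ a

Recurrent-↔ : ∀ {A B : Set} (e : A ↔ B) {u : ℕ → A} → Recurrent u → Recurrent (Inverse.to e ∘ u)
Recurrent-↔ e recurrent b N with recurrent (Inverse.from e b) N
... | n , N≤n , un≡ = n , N≤n , trans (cong (Inverse.to e) un≡) (Inverse.strictlyInverseˡ e b)

triangle : ℕ → ℕ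
triangle zero    = zero
triangle (suc d) = triangle d + suc d

n≤triangle : ∀ n → n ≤ triangle n
n≤triangle zero    = z≤n
n≤triangle (suc n) = m≤n+m (suc n) (triangle n)

nextInRow : ℕ × ℕ → ℕ × ℕ
nextInRow (d , a) with a ≟ d
... | yes _ = suc d , 0
... | no _  = d , suc a

nextInRow-end : ∀ d → nextInRow (d , d) ≡ (suc d , 0)
nextInRow-end d with d ≟ d
... | yes _   = refl
... | no d≢d  = contradiction refl d≢d

nextInRow-< : ∀ {d a} → a < d → nextInRow (d , a) ≡ (d , suc a)
nextInRow-< {d} {a} a<d with a ≟ d
... | yes refl = contradiction a<d (<-irrefl refl)
... | no _     = refl

diagonal : ℕ → ℕ × ℕ
diagonal zero    = 0 , 0
diagonal (suc n) = nextInRow (diagonal n)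

diagonal-triangle : ∀ d a → a ≤ d → diagonal (triangle d + a) ≡ (d , a)
diagonal-triangle zero    zero    _   = refl
diagonal-triangle (suc d) zero    _   = begin
  diagonal (triangle d + suc d + 0)    ≡⟨ cong diagonal (trans (+-identityʳ _) (+-suc (triangle d) d)) ⟩
  nextInRow (diagonal (triangle d + d)) ≡⟨ cong nextInRow (diagonal-triangle d d ≤-refl) ⟩
  nextInRow (d , d)                     ≡⟨ nextInRow-end d ⟩
  (suc d , 0)                           ∎
  where open ≡-Reasoning
diagonal-triangle d       (suc a) a<d = begin
  diagonal (triangle d + suc a)         ≡⟨ cong diagonal (+-suc (triangle d) a) ⟩
  nextInRow (diagonal (triangle d + a)) ≡⟨ cong nextInRow (diagonal-triangle d a (<⇒≤ a<d)) ⟩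
  nextInRow (d , a)                     ≡⟨ nextInRow-< a<d ⟩
  (d , suc a)                           ∎
  where open ≡-Reasoning

schedule : ℕ → ℕ
schedule = proj₂ ∘ diagonal

schedule-recurrent : Recurrent schedule
schedule-recurrent a N = triangle (N + a) + a , N≤n , cong proj₂ (diagonal-triangle (N + a) a (m≤n+m a N))
  where
  N≤n : N ≤ triangle (N + a) + a
  N≤n = ≤-trans (m≤m+n N a) (≤-trans (n≤triangle (N + a)) (m≤m+n _ a))

-- The greedy construction

-- {a , b} = {x , y}, the condition excluded by deleteEdge
Joins : {V : Set} → V → V → V → V → Set
Joins x y a b = (a ≡ x × b ≡ y) ⊎ (a ≡ y × b ≡ x)

Joins-sym : ∀ {V : Set} {x y a b : V} → Joins x y a b → Joins x y b a
Joins-sym (inj₁ (a≡x , b≡y)) = inj₂ (b≡y , a≡x)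
Joins-sym (inj₂ (a≡y , b≡x)) = inj₁ (b≡x , a≡y)

module Greedy {V : Set} (_≟_ : DecidableEquality V) (P : Property V) (hereditary : Hereditary _≟_ P) where

  -- the case split is that of fxy, so that the two unfold together
  edgeNbrs : V → V → V → List V
  edgeNbrs x y a with a ≟ x | a ≟ y
  ... | yes _ | _     = [ y ]
  ... | no _  | yes _ = [ x ]
  ... | no _  | no _  = []

  ∈-edgeNbrs⁻ : ∀ {x y a b} → b ∈ edgeNbrs x y a → Joins x y a b
  ∈-edgeNbrs⁻ {x} {y} {a} b∈ with a ≟ x | a ≟ y | b∈
  ... | yes a≡x | _       | here b≡y = inj₁ (a≡x , b≡y)
  ... | no _    | yes a≡y | here b≡x = inj₂ (a≡y , b≡x)

  ∈-edgeNbrs⁺ : ∀ {x y a b} → Joins x y a b → b ∈ edgeNbrs x y a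
  ∈-edgeNbrs⁺ {x} {y} {a} j with a ≟ x | a ≟ y | j
  ... | yes _   | _       | inj₁ (_ , b≡y)       = here b≡y
  ... | yes a≡x | _       | inj₂ (a≡y , b≡x)     = here (trans b≡x (trans (sym a≡x) a≡y))
  ... | no a≢x  | _       | inj₁ (a≡x , _)       = contradiction a≡x a≢x
  ... | no _    | yes _   | inj₂ (_ , b≡x)       = here b≡x
  ... | no _    | no a≢y  | inj₂ (a≡y , _)       = contradiction a≡y a≢y

  edgeNbrs-unique : ∀ x y a → Unique (edgeNbrs x y a)
  edgeNbrs-unique x y a with a ≟ x | a ≟ y
  ... | yes _ | _     = All.[] ∷ []
  ... | no _  | yes _ = All.[] ∷ []
  ... | no _  | no _  = []

  length-edgeNbrs-self : ∀ x y → length (edgeNbrs x y x) ≡ 1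
  length-edgeNbrs-self x y with x ≟ x
  ... | yes _   = refl
  ... | no x≢x  = contradiction refl x≢x

  fxy-split : ∀ (f : V → Card) {x y} → Positive (f x) → Positive (f y) →
              ∀ a → f a ≡ length (edgeNbrs x y a) +ᶜ fxy _≟_ f x y a
  fxy-split f {x} {y} fx>0 fy>0 a with a ≟ x | a ≟ y
  ... | yes refl | _      = positive⇒1+pred fx>0
  ... | no _     | yes refl = positive⇒1+pred fy>0
  ... | no _     | no _   = sym (+ᶜ-identityˡ (f a))

  record Stage : Set₁ where
    constructor mkStage
    field
      edges  : V → V → Set
      demand : V → Card
      holds  : Holds P edges demand
  open Stage

  graph : (s : Stage) → IsGraph (edges s)
  graph s = proj₁ (proj₁ (holds s))

  data Move (s : Stage) (x : V) : Set where
    pass  : demand s x ≡ fin 0 → Move s x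
    match : (y : V) → Positive (demand s x) → Positive (demand s y) → edges s x y →
            Holds P (deleteEdge (edges s) x y) (fxy _≟_ (demand s) x y) → Move s x

  move : (s : Stage) (x : V) → Move s x
  move s x with zero⊎positive (demand s x)
  ... | inj₁ x≡0  = pass x≡0
  ... | inj₂ x>0 with hereditary (edges s) (demand s) (graph s) (holds s) x x>0
  ...   | y , y>0 , xy , holds′ = match y x>0 y>0 xy holds′

  module _ {s : Stage} {x : V} where

    after : Move s x → Stage
    after (pass _)               = s
    after (match y _ _ _ holds′) = mkStage (deleteEdge (edges s) x y) (fxy _≟_ (demand s) x y) holds′

    gained : Move s x → V → List V
    gained (pass _)          _ = []
    gained (match y _ _ _ _)   = edgeNbrs x y

    after-⊆ : (m : Move s x) → ∀ {a b} → edges (after m) a b → edges s a b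
    after-⊆ (pass _)          ab = ab
    after-⊆ (match _ _ _ _ _) ab = proj₁ ab

    gained⊆edges : (m : Move s x) → ∀ {a b} → b ∈ gained m a → edges s a b
    gained⊆edges (match y _ _ xy _) b∈ with ∈-edgeNbrs⁻ b∈
    ... | inj₁ (refl , refl) = xy
    ... | inj₂ (refl , refl) = proj₁ (graph s) _ _ xy

    gained-deleted : (m : Move s x) → ∀ {a b} → b ∈ gained m a → ¬ edges (after m) a b
    gained-deleted (match _ _ _ _ _) b∈ (_ , ¬joins) = ¬joins (∈-edgeNbrs⁻ b∈)

    gained-sym : (m : Move s x) → ∀ {a b} → b ∈ gained m a → a ∈ gained m b
    gained-sym (match _ _ _ _ _) = ∈-edgeNbrs⁺ ∘ Joins-sym ∘ ∈-edgeNbrs⁻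

    gained-unique : (m : Move s x) → ∀ a → Unique (gained m a)
    gained-unique (pass _)          _ = []
    gained-unique (match y _ _ _ _) a = edgeNbrs-unique x y a

    demand-split : (m : Move s x) → ∀ a → demand s a ≡ length (gained m a) +ᶜ demand (after m) a
    demand-split (pass _)              a = sym (+ᶜ-identityˡ (demand s a))
    demand-split (match _ x>0 y>0 _ _) a = fxy-split (demand s) x>0 y>0 a

    gained-self : (m : Move s x) → demand s x ≡ fin 0 ⊎ length (gained m x) ≡ 1
    gained-self (pass x≡0)        = inj₁ x≡0
    gained-self (match y _ _ _ _) = inj₂ (length-edgeNbrs-self x y)

  module Run (s₀ : Stage) (visit : ℕ → V) where

    stage : ℕ → Stage
    moveAt : ∀ n → Move (stage n) (visit n)

    stage zero    = s₀
    stage (suc n) = after (moveAt n)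

    moveAt n = move (stage n) (visit n)

    Factor : V → V → Set
    Factor a b = ∃ λ n → b ∈ gained (moveAt n) a

    matched : V → ℕ → List V
    matched a = concatUpTo (λ n → gained (moveAt n) a)

    edges-antitone : ∀ {m n} → m ≤′ n → ∀ {a b} → edges (stage n) a b → edges (stage m) a b
    edges-antitone ≤′-refl            ab = ab
    edges-antitone (≤′-step {n} m≤n) ab = edges-antitone m≤n (after-⊆ (moveAt n) ab)

    Factor⊆edges : ∀ a b → Factor a b → edges s₀ a b
    Factor⊆edges a b (n , b∈) = edges-antitone {n = n} (≤⇒≤′ z≤n) (gained⊆edges (moveAt n) b∈)

    Factor-sym : ∀ a b → Factor a b → Factor b a
    Factor-sym a b (n , b∈) = n , gained-sym (moveAt n) b∈

    -- an edge gained at step m is deleted from every later stage, so it is not gained again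
    matched-unique : ∀ a n → Unique (matched a n)
    matched-unique a zero    = []
    matched-unique a (suc n) = ++⁺ (matched-unique a n) (gained-unique (moveAt n) a) disjoint
      where
      disjoint : Disjoint (matched a n) (gained (moveAt n) a)
      disjoint (b∈matched , b∈gained) with ∈-concatUpTo⁻ _ n b∈matched
      ... | m , m<n , b∈gainedₘ =
        gained-deleted (moveAt m) b∈gainedₘ (edges-antitone (≤⇒≤′ m<n) (gained⊆edges (moveAt n) b∈gained))

    demand-invariant : ∀ a n → demand s₀ a ≡ length (matched a n) +ᶜ demand (stage n) a
    demand-invariant a zero    = sym (+ᶜ-identityˡ (demand s₀ a))
    demand-invariant a (suc n) = begin
      demand s₀ a                                         ≡⟨ demand-invariant a n ⟩
      length (matched a n) +ᶜ demand (stage n) a          ≡⟨ cong (length (matched a n) +ᶜ_) (demand-split (moveAt n) a) ⟩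
      length (matched a n) +ᶜ (length gainedₙ +ᶜ demandₙ₊₁) ≡⟨ +ᶜ-assoc (length (matched a n)) (length gainedₙ) demandₙ₊₁ ⟩
      (length (matched a n) + length gainedₙ) +ᶜ demandₙ₊₁  ≡⟨ cong (_+ᶜ demandₙ₊₁) (length-++ (matched a n)) ⟨
      length (matched a (suc n)) +ᶜ demandₙ₊₁              ∎
      where
      open ≡-Reasoning
      gainedₙ   = gained (moveAt n) a
      demandₙ₊₁ = demand (stage (suc n)) a

    matched-bounded : ∀ a n → length (matched a n) ≤ᶜ demand s₀ a
    matched-bounded a n = subst (length (matched a n) ≤ᶜ_) (sym (demand-invariant a n)) (≤ᶜ-+ᶜ _ _)

    visit-progress : ∀ {a} n → visit n ≡ a →
                     demand (stage n) a ≡ fin 0 ⊎ length (matched a (suc n)) ≡ suc (length (matched a n))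
    visit-progress {a} n refl with gained-self (moveAt n)
    ... | inj₁ a≡0   = inj₁ a≡0
    ... | inj₂ len≡1 = inj₂ (trans (length-++ (matched a n)) (trans (cong (length (matched a n) +_) len≡1) (+-comm _ 1)))

    exhausts : Recurrent visit → ∀ a j → ∃ λ N → j ≤ length (matched a N) ⊎ demand (stage N) a ≡ fin 0
    exhausts recurrent a zero = 0 , inj₁ z≤n
    exhausts recurrent a (suc j) with exhausts recurrent a j
    ... | N , inj₂ a≡0 = N , inj₂ a≡0
    ... | N , inj₁ j≤N with recurrent a N
    ...   | n , N≤n , visit≡a with visit-progress n visit≡a
    ...     | inj₁ a≡0 = n , inj₂ a≡0
    ...     | inj₂ len≡ = suc n , inj₁ (subst (suc j ≤_) (sym len≡)
                            (s≤s (≤-trans j≤N (length-concatUpTo-mono _ (≤⇒≤′ N≤n)))))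

    matched-unbounded : Recurrent visit → ∀ a l → l ≤ᶜ demand s₀ a → ∃ λ N → l ≤ length (matched a N)
    matched-unbounded recurrent a l l≤a with exhausts recurrent a l
    ... | N , inj₁ l≤N = N , l≤N
    ... | N , inj₂ a≡0 = N , ≤-trans l≤N+0 (≤-reflexive (+-identityʳ _))
      where
      l≤N+0 : l ≤ᶜ (length (matched a N) +ᶜ fin 0)
      l≤N+0 = subst (l ≤ᶜ_) (trans (demand-invariant a N) (cong (length (matched a N) +ᶜ_) a≡0)) l≤a

    perfectFactor : Recurrent visit → PerfectFactor (edges s₀) (demand s₀) Factor
    perfectFactor recurrent =
      Factor⊆edges , Factor-sym ,
      λ a → hasCard-⋃ (λ n → gained (moveAt n) a) (demand s₀ a)
              (matched-unique a) (matched-bounded a) (matched-unbounded recurrent a)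

theorem1 : (V : Set) (e : ℕ ↔ V) (E : V → V → Set) (f : V → Card) →
    IsGraph E → InC E f → (P : Property V) → Hereditary (decEqV e) P →
    Holds P E f → Σ (V → V → Set) λ F → PerfectFactor E f F
-- IsGraph E and InC E f are already components of Holds P E f.
theorem1 V e E f _ _ P hereditary holds =
  Factor , perfectFactor (Recurrent-↔ e schedule-recurrent)
  where
  open Greedy (decEqV e) P hereditary
  open Run (mkStage E f holds) (Inverse.to e ∘ schedule)
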